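{- For every $i \geq 1$: if $i$ is good, then $\ell_i$ is good.
   Context: Define finite binary words $B_i$ by $B_1 = 101$ and $B_{i+1} = B_i C_i$ for $i \geq 1$, where $C_i$ is the word obtained from $B_i$ by removing its first $i$ symbols. Let $\ell_i = |B_i|$ (one has $\ell_i = 2^{i-1}+i+1$). Words are indexed starting at position $1$, and $w[j..k]$ denotes the factor of $w$ from position $j$ to position $k$. An index $i \geq 1$ is called good if $B_i$ has a border of length $i$, i.e., $B_i[1..i] = B_i[\ell_i - i + 1..\ell_i]$. -}

module Defs where

open import Data.Nat using (ℕ; zero; suc; _∸_)
open import Data.Bool using (Bool; true; false)
open import Data.List using (List; []; _∷_; _++_; take; drop; length)
open import Relation.Binary.PropositionalEquality using (_≡_)

-- Binary words are lists of booleans (true = 1, false = 0).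
Word : Set
Word = List Bool

-- Bs n = B_{n+1} (the paper indexes from 1).
--   B_1 = 101,  B_{i+1} = B_i C_i  with  C_i = B_i with its first i symbols removed.
Bs : ℕ → Word
Bs zero    = true ∷ false ∷ true ∷ []
Bs (suc n) = Bs n ++ drop (suc n) (Bs n)

-- B i for i ≥ 1 is B_i; B 0 is never used (set to the empty word).
B : ℕ → Word
B zero    = []
B (suc n) = Bs n

ℓ : ℕ → ℕ
ℓ i = length (B i)

Good : ℕ → Set
Good i = take i (B i) ≡ drop (ℓ i ∸ i) (B i)

-- The words B_j form a prefix chain, so B_i is a prefix of every later B_j. Each step
-- B_{j+1} = B_j C_j appends a block C_j of length 2^(j-1) + 1, which for j > i is at least
-- ℓ_i; hence the suffix of length ℓ_i no longer changes after B_{i+1}. That suffix is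
-- B_i[ℓ_i-i+1..ℓ_i] C_i, which by the border of length i equals B_i[1..i] C_i = B_i.
-- So every B_j with j > i, in particular B_{ℓ_i}, has a border of length ℓ_i.
module Submission where

open import Defs
open import Data.Nat using (ℕ; _≥_; zero; suc; _+_; _∸_; _^_; _≤_; _<_; z≤n; s≤s)
open import Data.Nat.Properties
open import Data.List using (List; []; _∷_; _++_; take; drop; length)
open import Data.List.Properties using (length-++; length-drop; ++-assoc; ++-identityʳ; take++drop≡id)
open import Data.Product using (∃-syntax; _,_)
open import Function using (_∘_)
open import Relation.Binary.PropositionalEquality
open import Data.Nat.Tactic.RingSolver using (solve-∀)

module _ {a} {A : Set a} where

  suffix : ℕ → List A → List A
  suffix k w = drop (length w ∸ k) w

  HasBorder : ℕ → List A → Set a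
  HasBorder k w = take k w ≡ suffix k w

  take-length-++ : (xs ys : List A) → take (length xs) (xs ++ ys) ≡ xs
  take-length-++ []       ys = refl
  take-length-++ (x ∷ xs) ys = cong (x ∷_) (take-length-++ xs ys)

  drop-++ˡ : (xs ys : List A) {d : ℕ} → d ≤ length xs →
             drop d (xs ++ ys) ≡ drop d xs ++ ys
  drop-++ˡ xs       ys {zero}  _       = refl
  drop-++ˡ (x ∷ xs) ys {suc d} (s≤s p) = drop-++ˡ xs ys p

  drop-length-++ : (xs ys : List A) (d : ℕ) → drop (length xs + d) (xs ++ ys) ≡ drop d ys
  drop-length-++ []       ys d = refl
  drop-length-++ (x ∷ xs) ys d = drop-length-++ xs ys d

  suffix-++ʳ : (xs ys : List A) {k : ℕ} → k ≤ length ys →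
               suffix k (xs ++ ys) ≡ suffix k ys
  suffix-++ʳ xs ys {k} k≤ys = begin
    drop (length (xs ++ ys) ∸ k) zs
      ≡⟨ cong (λ m → drop (m ∸ k) zs) (length-++ xs) ⟩
    drop (length xs + length ys ∸ k) zs
      ≡⟨ cong (λ m → drop m zs) (+-∸-assoc (length xs) k≤ys) ⟩
    drop (length xs + (length ys ∸ k)) zs
      ≡⟨ drop-length-++ xs ys (length ys ∸ k) ⟩
    suffix k ys ∎
    where
    open ≡-Reasoning
    zs : List A
    zs = xs ++ ys

  suffix-++ : (xs ys : List A) (k : ℕ) → suffix (k + length ys) (xs ++ ys) ≡ suffix k xs ++ ys
  suffix-++ xs ys k = begin
    drop (length (xs ++ ys) ∸ (k + length ys)) zs
      ≡⟨ cong (λ m → drop (m ∸ (k + length ys)) zs) (length-++ xs) ⟩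
    drop (length xs + length ys ∸ (k + length ys)) zs
      ≡⟨ cong₂ (λ m n → drop (m ∸ n) zs) (+-comm (length xs) _) (+-comm k _) ⟩
    drop (length ys + length xs ∸ (length ys + k)) zs
      ≡⟨ cong (λ m → drop m zs) ([m+n]∸[m+o]≡n∸o (length ys) (length xs) k) ⟩
    drop (length xs ∸ k) zs
      ≡⟨ drop-++ˡ xs ys (m∸n≤m (length xs) k) ⟩
    suffix k xs ++ ys ∎
    where
    open ≡-Reasoning
    zs : List A
    zs = xs ++ ys

  suffix-drop : (d : ℕ) (w : List A) {k : ℕ} → k ≤ length (drop d w) →
                suffix k (drop d w) ≡ suffix k w
  suffix-drop d w {k} k≤ = begin
    suffix k (drop d w)              ≡⟨ suffix-++ʳ (take d w) (drop d w) k≤ ⟨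
    suffix k (take d w ++ drop d w)  ≡⟨ cong (suffix k) (take++drop≡id d w) ⟩
    suffix k w                       ∎
    where open ≡-Reasoning

  border⇒suffix-++-drop : (w : List A) {k : ℕ} → k ≤ length w → HasBorder k w →
                          suffix (length w) (w ++ drop k w) ≡ w
  border⇒suffix-++-drop w {k} k≤w border = begin
    suffix (length w) (w ++ drop k w)               ≡⟨ cong (λ m → suffix m (w ++ drop k w)) length-w ⟩
    suffix (k + length (drop k w)) (w ++ drop k w)  ≡⟨ suffix-++ w (drop k w) k ⟩
    suffix k w ++ drop k w                          ≡⟨ cong (_++ drop k w) border ⟨
    take k w ++ drop k w                            ≡⟨ take++drop≡id k w ⟩
    w                                               ∎
    where
    open ≡-Reasoning
    length-w : length w ≡ k + length (drop k w)
    length-w = trans (sym (m+[n∸m]≡n k≤w)) (cong (k +_) (sym (length-drop k w)))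

n<2^n : ∀ n → n < 2 ^ n
n<2^n zero    = s≤s z≤n
n<2^n (suc n) = subst (suc n <_) (cong (2 ^ n +_) (sym (+-identityʳ (2 ^ n))))
                      (+-mono-≤-< (m^n>0 2 n) (n<2^n n))

-- C n is the paper's C_{n+1}, so that Bs (suc n) = Bs n ++ C n.
C : ℕ → Word
C n = drop (suc n) (Bs n)

length-Bs : ∀ n → length (Bs n) ≡ suc (2 ^ n + suc n)
length-C  : ∀ n → length (C n) ≡ suc (2 ^ n)

length-C n = begin
  length (drop (suc n) (Bs n))  ≡⟨ length-drop (suc n) (Bs n) ⟩
  length (Bs n) ∸ suc n         ≡⟨ cong (_∸ suc n) (length-Bs n) ⟩
  suc (2 ^ n) + suc n ∸ suc n   ≡⟨ m+n∸n≡m (suc (2 ^ n)) (suc n) ⟩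
  suc (2 ^ n)                   ∎
  where open ≡-Reasoning

length-Bs zero    = refl
length-Bs (suc n) = begin
  length (Bs n ++ C n)                   ≡⟨ length-++ (Bs n) ⟩
  length (Bs n) + length (C n)           ≡⟨ cong₂ _+_ (length-Bs n) (length-C n) ⟩
  suc (2 ^ n + suc n) + suc (2 ^ n)      ≡⟨ arithmetic (2 ^ n) n ⟩
  suc (2 ^ suc n + suc (suc n))          ∎
  where
  open ≡-Reasoning
  arithmetic : ∀ p n → suc (p + suc n) + suc p ≡ suc (p + (p + 0) + suc (suc n))
  arithmetic = solve-∀

length-Bs≤length-C : ∀ {n j} → n < j → length (Bs n) ≤ length (C j)
length-Bs≤length-C {n} {j} n<j = begin
  length (Bs n)        ≡⟨ length-Bs n ⟩
  suc (2 ^ n + suc n)  ≤⟨ s≤s (+-monoʳ-≤ (2 ^ n) (n<2^n n)) ⟩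
  suc (2 ^ n + 2 ^ n)  ≡⟨ cong (λ m → suc (2 ^ n + m)) (+-identityʳ (2 ^ n)) ⟨
  suc (2 ^ suc n)      ≤⟨ s≤s (^-monoʳ-≤ 2 n<j) ⟩
  suc (2 ^ j)          ≡⟨ length-C j ⟨
  length (C j)         ∎
  where open ≤-Reasoning

Bs-extends : ∀ k n → ∃[ t ] Bs (k + n) ≡ Bs n ++ t
Bs-extends zero    n = _ , sym (++-identityʳ (Bs n))
Bs-extends (suc k) n with Bs-extends k n
... | t , eq = t ++ C (k + n) , trans (cong (_++ C (k + n)) eq) (++-assoc (Bs n) t (C (k + n)))

take-length-Bs : ∀ k n → take (length (Bs n)) (Bs (k + n)) ≡ Bs n
take-length-Bs k n with Bs-extends k n
... | t , eq rewrite eq = take-length-++ (Bs n) t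

suffix-length-Bs : ∀ k n →
                   suffix (length (Bs n)) (Bs (k + suc n)) ≡ suffix (length (Bs n)) (Bs (suc n))
suffix-length-Bs zero    n = refl
suffix-length-Bs (suc k) n = begin
  suffix L (Bs j ++ C j)  ≡⟨ suffix-++ʳ (Bs j) (C j) L≤C ⟩
  suffix L (C j)          ≡⟨ suffix-drop (suc j) (Bs j) L≤C ⟩
  suffix L (Bs j)         ≡⟨ suffix-length-Bs k n ⟩
  suffix L (Bs (suc n))   ∎
  where
  open ≡-Reasoning
  L : ℕ
  L = length (Bs n)
  j : ℕ
  j = k + suc n
  L≤C : L ≤ length (C j)
  L≤C = length-Bs≤length-C (m≤n+m (suc n) k)

border-persists : ∀ n → HasBorder (suc n) (Bs n) →
                  ∀ k → HasBorder (length (Bs n)) (Bs (k + suc n))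
border-persists n border k = begin
  take L (Bs (k + suc n))    ≡⟨ cong (take L ∘ Bs) (+-suc k n) ⟩
  take L (Bs (suc k + n))    ≡⟨ take-length-Bs (suc k) n ⟩
  Bs n                       ≡⟨ border⇒suffix-++-drop (Bs n) suc-n≤L border ⟨
  suffix L (Bs (suc n))      ≡⟨ suffix-length-Bs k n ⟨
  suffix L (Bs (k + suc n))  ∎
  where
  open ≡-Reasoning
  L : ℕ
  L = length (Bs n)
  suc-n≤L : suc n ≤ L
  suc-n≤L = subst (suc n ≤_) (sym (length-Bs n)) (m≤n⇒m≤1+n (m≤n+m (suc n) (2 ^ n)))

lemma2 : (i : ℕ) → i ≥ 1 → Good i → Good (ℓ i)
lemma2 (suc n) _ good =
  subst (λ j → HasBorder (ℓ (suc n)) (B j)) (sym (length-Bs n)) (border-persists n good (2 ^ n))
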